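{- Let $Q$ be a second-order polynomial of type $\mathbf{m}$ with $\deg(Q)>0$. Then there are a first-order multivariate polynomial $t$ and finitely many second-order polynomials $Q_1,\ldots,Q_n$ with $Q=t(\mathtt{L}(Q_1),\ldots,\mathtt{L}(Q_n))$ and $\max_{i\le n}\deg(Q_i)+2=\deg(Q)$.
   Context: Second-order polynomials (in a type-1 variable $\mathtt{L}$ and a type-0 variable $\mathtt{n}$) are defined inductively: every positive integer and $\mathtt{n}$ are second-order polynomials, and if $P,Q$ are, so are $P+Q$, $P\cdot Q$ and $\mathtt{L}(P)$. Second-order degree and type: constants and $\mathtt{n}$ have degree $0$ and type $\mathbf{m}$; $\deg\mathtt{L}(P)=\deg P+1$, of type $\mathbf{a}$; for $P+Q$ and $P\cdot Q$ let $d=\max\{\deg P,\deg Q\}$ and call the pair critical if $P$ has type $\mathbf{a}$ and $\deg P=d$, or $Q$ has type $\mathbf{a}$ and $\deg Q=d$; $\deg(P+Q)=d$, of type $\mathbf{a}$ if critical and $\mathbf{m}$ otherwise; $\deg(P\cdot Q)=d+1$ if critical and $d$ otherwise, always of type $\mathbf{m}$. -}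

module Defs where

open import Data.Nat using (ℕ; zero; suc; _+_; _⊔_; _≡ᵇ_)
open import Data.Bool using (Bool; true; false; _∧_; _∨_; if_then_else_)
open import Data.Fin using (Fin; zero; suc)
open import Data.Product using (_×_; _,_; proj₁; proj₂)

-- Second-order polynomials in a type-1 variable L and a type-0 variable n
-- (syntax trees).  `pos k` denotes the positive integer k+1.
data SOP : Set where
  pos  : ℕ → SOP
  nv   : SOP
  _⊕_  : SOP → SOP → SOP
  _⊗_  : SOP → SOP → SOP
  L    : SOP → SOP

infixl 6 _⊕_
infixl 7 _⊗_

data Ty : Set where
  𝐚 𝐦 : Ty

isA : Ty → Bool
isA 𝐚 = true
isA 𝐦 = false

critical : ℕ → Ty → ℕ → Ty → Bool
critical dp tp dq tq =
  (isA tp ∧ (dp ≡ᵇ (dp ⊔ dq))) ∨ (isA tq ∧ (dq ≡ᵇ (dp ⊔ dq)))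

degTy : SOP → ℕ × Ty
degTy (pos k) = 0 , 𝐦
degTy nv      = 0 , 𝐦
degTy (L P)   = suc (proj₁ (degTy P)) , 𝐚
degTy (P ⊕ Q) with degTy P | degTy Q
... | dp , tp | dq , tq =
  (dp ⊔ dq) , (if critical dp tp dq tq then 𝐚 else 𝐦)
degTy (P ⊗ Q) with degTy P | degTy Q
... | dp , tp | dq , tq =
  (if critical dp tp dq tq then suc (dp ⊔ dq) else (dp ⊔ dq)) , 𝐦

deg : SOP → ℕ
deg P = proj₁ (degTy P)

type : SOP → Ty
type P = proj₂ (degTy P)

-- First-order multivariate polynomials in variables x_0..x_{k-1}
-- (positive integer constants `cst c` = c+1, the type-0 variable n, + and ·).
data FOP (k : ℕ) : Set where
  cst  : ℕ → FOP k
  nvar : FOP k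
  var  : Fin k → FOP k
  _+ᶠ_ : FOP k → FOP k → FOP k
  _*ᶠ_ : FOP k → FOP k → FOP k

applyL : {k : ℕ} → FOP k → (Fin k → SOP) → SOP
applyL (cst c)    Qs = pos c
applyL nvar       Qs = nv
applyL (var i)    Qs = L (Qs i)
applyL (s +ᶠ t)   Qs = applyL s Qs ⊕ applyL t Qs
applyL (s *ᶠ t)   Qs = applyL s Qs ⊗ applyL t Qs

maxFin : {k : ℕ} → (Fin k → ℕ) → ℕ
maxFin {zero}  f = 0
maxFin {suc k} f = f zero ⊔ maxFin (λ i → f (suc i))

-- Cut Q at its outermost applications of L: Q = t(L(Q₁),…,L(Qₙ)) with t first-order.
-- If d is the largest deg Qᵢ, then (deg Q, type Q) is (0,𝐦) when n = 0, and otherwise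
-- (d+1,𝐚) or (d+2,𝐦).  This is preserved by sums, which pick the larger of the two
-- summands' shapes in the order (d+1,𝐚) < (d+2,𝐦) < (d+2,𝐚), and by products, which
-- behave like sums except that a result of type 𝐚 becomes one of type 𝐦 and one degree
-- higher.  Hence type 𝐦 and positive degree force deg Q = d + 2.
module Submission where

open import Defs
open import Data.Bool using (true; false; if_then_else_)
open import Data.Bool.Properties using (T-≡; ∨-zeroʳ)
open import Data.Fin using (Fin; zero; suc; _↑ˡ_; _↑ʳ_)
open import Data.Nat using (ℕ; zero; suc; _+_; _⊔_; _≡ᵇ_; _<_; _>_; s≤s)
open import Data.Nat.Properties
  using (≡⇒≡ᵇ; ⊔-assoc; ⊔-identityʳ; m≤n⇒m⊔n≡n; m≥n⇒m⊔n≡m; m≤n⇒m≤1+n; <⇒≤; ≤-<-connex; +-comm)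
open import Data.Product using (Σ; _×_; _,_; proj₁; proj₂)
open import Data.Sum using (inj₁; inj₂)
open import Data.Vec.Functional using (Vector; _++_)
open import Data.Vec.Functional.Properties using (lookup-++ˡ; lookup-++ʳ)
open import Function using (_∘_; Equivalence)
open import Relation.Binary.PropositionalEquality
  using (_≡_; refl; sym; trans; cong; cong₂; subst; subst₂; _≗_)

private
  variable
    A : Set
    k k′ m n : ℕ

maxFin-cong : {f g : Fin k → ℕ} → f ≗ g → maxFin f ≡ maxFin g
maxFin-cong {zero}  f≗g = refl
maxFin-cong {suc k} f≗g = cong₂ _⊔_ (f≗g zero) (maxFin-cong (f≗g ∘ suc))

maxFin-split : ∀ m {n} (f : Fin (m + n) → ℕ) →
               maxFin f ≡ maxFin (f ∘ (_↑ˡ n)) ⊔ maxFin (f ∘ (m ↑ʳ_))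
maxFin-split zero    f = refl
maxFin-split (suc m) f =
  trans (cong (f zero ⊔_) (maxFin-split m (f ∘ suc)))
        (sym (⊔-assoc (f zero) _ _))

maxFin-++ : (h : A → ℕ) (xs : Vector A m) (ys : Vector A n) →
            maxFin (h ∘ (xs ++ ys)) ≡ maxFin (h ∘ xs) ⊔ maxFin (h ∘ ys)
maxFin-++ {m = m} h xs ys =
  trans (maxFin-split m (h ∘ (xs ++ ys)))
        (cong₂ _⊔_ (maxFin-cong (cong h ∘ lookup-++ˡ xs ys))
                   (maxFin-cong (cong h ∘ lookup-++ʳ xs ys)))

rename : (Fin k → Fin k′) → FOP k → FOP k′
rename ρ (cst c)  = cst c
rename ρ nvar     = nvar
rename ρ (var i)  = var (ρ i)
rename ρ (s +ᶠ t) = rename ρ s +ᶠ rename ρ t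
rename ρ (s *ᶠ t) = rename ρ s *ᶠ rename ρ t

applyL-rename : (ρ : Fin k → Fin k′) (t : FOP k) {f : Fin k′ → SOP} {g : Fin k → SOP} →
                f ∘ ρ ≗ g → applyL (rename ρ t) f ≡ applyL t g
applyL-rename ρ (cst c)  eq = refl
applyL-rename ρ nvar     eq = refl
applyL-rename ρ (var i)  eq = cong L (eq i)
applyL-rename ρ (s +ᶠ t) eq = cong₂ _⊕_ (applyL-rename ρ s eq) (applyL-rename ρ t eq)
applyL-rename ρ (s *ᶠ t) eq = cong₂ _⊗_ (applyL-rename ρ s eq) (applyL-rename ρ t eq)

#outerL : SOP → ℕ
#outerL (pos _) = 0
#outerL nv      = 0
#outerL (L _)   = 1
#outerL (u ⊕ v) = #outerL u + #outerL v
#outerL (u ⊗ v) = #outerL u + #outerL v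

outerArgs : (Q : SOP) → Vector SOP (#outerL Q)
outerArgs (pos _) ()
outerArgs nv      ()
outerArgs (L R)   _ = R
outerArgs (u ⊕ v)   = outerArgs u ++ outerArgs v
outerArgs (u ⊗ v)   = outerArgs u ++ outerArgs v

skeleton : (Q : SOP) → FOP (#outerL Q)
skeleton (pos c) = cst c
skeleton nv      = nvar
skeleton (L _)   = var zero
skeleton (u ⊕ v) = rename (_↑ˡ #outerL v) (skeleton u) +ᶠ rename (#outerL u ↑ʳ_) (skeleton v)
skeleton (u ⊗ v) = rename (_↑ˡ #outerL v) (skeleton u) *ᶠ rename (#outerL u ↑ʳ_) (skeleton v)

applyL-skeleton-++ˡ : (u v : SOP) →
  u ≡ applyL (rename (_↑ˡ #outerL v) (skeleton u)) (outerArgs u ++ outerArgs v)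
applyL-skeleton-++ʳ : (u v : SOP) →
  v ≡ applyL (rename (#outerL u ↑ʳ_) (skeleton v)) (outerArgs u ++ outerArgs v)

applyL-skeleton : (Q : SOP) → Q ≡ applyL (skeleton Q) (outerArgs Q)
applyL-skeleton (pos c) = refl
applyL-skeleton nv      = refl
applyL-skeleton (L R)   = refl
applyL-skeleton (u ⊕ v) = cong₂ _⊕_ (applyL-skeleton-++ˡ u v) (applyL-skeleton-++ʳ u v)
applyL-skeleton (u ⊗ v) = cong₂ _⊗_ (applyL-skeleton-++ˡ u v) (applyL-skeleton-++ʳ u v)

applyL-skeleton-++ˡ u v =
  trans (applyL-skeleton u)
        (sym (applyL-rename _ (skeleton u) (lookup-++ˡ (outerArgs u) (outerArgs v))))

applyL-skeleton-++ʳ u v =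
  trans (applyL-skeleton v)
        (sym (applyL-rename _ (skeleton v) (lookup-++ʳ (outerArgs u) (outerArgs v))))

outerDeg : SOP → ℕ
outerDeg Q = maxFin (deg ∘ outerArgs Q)

sumDegTy : ℕ × Ty → ℕ × Ty → ℕ × Ty
sumDegTy (dp , tp) (dq , tq) = dp ⊔ dq , (if critical dp tp dq tq then 𝐚 else 𝐦)

raise : ℕ × Ty → ℕ × Ty
raise (d , 𝐚) = suc d , 𝐦
raise (d , 𝐦) = d , 𝐦

degTy-⊗ : (P Q : SOP) → degTy (P ⊗ Q) ≡ raise (degTy (P ⊕ Q))
degTy-⊗ P Q with degTy P | degTy Q
... | dp , tp | dq , tq with critical dp tp dq tq
...   | true  = refl
...   | false = refl

≡ᵇ-refl : ∀ m → (m ≡ᵇ m) ≡ true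
≡ᵇ-refl m = Equivalence.to T-≡ (≡⇒≡ᵇ m m refl)

<⇒≡ᵇ-false : m < n → (m ≡ᵇ n) ≡ false
<⇒≡ᵇ-false {zero}  {suc n} _         = refl
<⇒≡ᵇ-false {suc m} {suc n} (s≤s m<n) = <⇒≡ᵇ-false m<n

-- The (degree, type) pairs possible for a polynomial whose outer L-arguments have
-- maximal degree m (with m = 0 when there are none).
data Shape : ℕ × Ty → ℕ → Set where
  ground   : Shape (0 , 𝐦) 0
  atomic   : ∀ m → Shape (suc m , 𝐚) m
  compound : ∀ m → Shape (suc (suc m) , 𝐦) m

shape-raise : ∀ {x} → Shape x m → Shape (raise x) m
shape-raise ground       = ground
shape-raise (atomic m)   = compound m
shape-raise (compound m) = compound m

shape-⊔-identityʳ : ∀ {x} → Shape x m → Shape x (m ⊔ 0)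
shape-⊔-identityʳ {m} = subst (Shape _) (sym (⊔-identityʳ m))

shape-sum : ∀ {x y} → Shape x m → Shape y n → Shape (sumDegTy x y) (m ⊔ n)
shape-sum ground       ground       = ground
shape-sum ground       (atomic n)   rewrite ≡ᵇ-refl n = atomic n
shape-sum ground       (compound n) = compound n
shape-sum (atomic m)   ground       rewrite ≡ᵇ-refl m = shape-⊔-identityʳ (atomic m)
shape-sum (compound m) ground       = shape-⊔-identityʳ (compound m)
shape-sum (compound m) (compound n) = compound (m ⊔ n)
shape-sum (atomic m) (atomic n) with ≤-<-connex m n
... | inj₁ m≤n rewrite m≤n⇒m⊔n≡n m≤n | ≡ᵇ-refl n | ∨-zeroʳ (m ≡ᵇ n) = atomic n
... | inj₂ n<m rewrite m≥n⇒m⊔n≡m (<⇒≤ n<m) | ≡ᵇ-refl m = atomic m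
shape-sum (atomic m) (compound n) with ≤-<-connex m n
... | inj₁ m≤n rewrite m≤n⇒m⊔n≡n (m≤n⇒m≤1+n m≤n) | <⇒≡ᵇ-false (s≤s m≤n) | m≤n⇒m⊔n≡n m≤n
  = compound n
... | inj₂ n<m rewrite m≥n⇒m⊔n≡m n<m | ≡ᵇ-refl m | m≥n⇒m⊔n≡m (<⇒≤ n<m) = atomic m
shape-sum (compound m) (atomic n) with ≤-<-connex n m
... | inj₁ n≤m rewrite m≥n⇒m⊔n≡m (m≤n⇒m≤1+n n≤m) | <⇒≡ᵇ-false (s≤s n≤m) | m≥n⇒m⊔n≡m n≤m
  = compound m
... | inj₂ m<n rewrite m≤n⇒m⊔n≡n m<n | ≡ᵇ-refl n | m≤n⇒m⊔n≡n (<⇒≤ m<n) = atomic n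

shape : (Q : SOP) → Shape (degTy Q) (outerDeg Q)
shape (pos _) = ground
shape nv      = ground
shape (L R)   = shape-⊔-identityʳ (atomic (deg R))
shape (u ⊕ v) = subst (Shape _) (sym (maxFin-++ deg (outerArgs u) (outerArgs v)))
                  (shape-sum (shape u) (shape v))
shape (u ⊗ v) = subst₂ Shape (sym (degTy-⊗ u v)) (sym (maxFin-++ deg (outerArgs u) (outerArgs v)))
                  (shape-raise (shape-sum (shape u) (shape v)))

shape-𝐦-positive : ∀ {x} → Shape x m → proj₂ x ≡ 𝐦 → proj₁ x > 0 → proj₁ x ≡ m + 2
shape-𝐦-positive ground       _    ()
shape-𝐦-positive (atomic m)   ()   _
shape-𝐦-positive (compound m) refl _ = +-comm 2 m

lemma7 : (Q : SOP) → type Q ≡ 𝐦 → deg Q > 0 →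
    Σ ℕ (λ k → Σ (FOP k) (λ t → Σ (Fin k → SOP) (λ Qs →
      (Q ≡ applyL t Qs) × (maxFin (λ i → deg (Qs i)) + 2 ≡ deg Q))))
lemma7 Q type-𝐦 deg>0 =
  #outerL Q , skeleton Q , outerArgs Q , applyL-skeleton Q ,
  sym (shape-𝐦-positive (shape Q) type-𝐦 deg>0)
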